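{- The map $B_n\ni\tau\mapsto\widetilde{\Omega}(\tau)\in\mathcal{P}(X)$ is order preserving, where $B_n$ carries the partial order defined by $\ell_B$ and $\mathcal{P}(X)$ (the set of all partitions of $X$) is ordered by reverse refinement.
   Context: $n\ge1$, $X=\{\pm1,\dots,\pm n\}$; $B_n$ is the group of permutations $\tau$ of $X$ with $\tau(-i)=-\tau(i)$. $\ell_B(\tau)$ is the minimal number of factors writing $\tau$ as a product of elements of $\{(i,j)(-i,-j),(i,-j)(-i,j):1\le i<j\le n\}\cup\{(i,-i):1\le i\le n\}$; $\sigma\le\tau$ iff $\ell_B(\tau)=\ell_B(\sigma)+\ell_B(\sigma^{ -1}\tau)$. $\widetilde{\Omega}(\tau)$ is obtained from the partition of $X$ into orbits of $\tau$ by merging all blocks $A$ with $A=-A$ into a single block. Reverse refinement: $\pi\le\rho$ iff every block of $\rho$ is a union of blocks of $\pi$. -}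

module Defs where

open import Data.Nat using (ℕ; _+_; _≤_; _<_)
open import Data.Bool using (Bool; true; false; not)
open import Data.Fin using (Fin; toℕ; _≟_)
open import Data.Product using (Σ; _×_; _,_; ∃; ∃-syntax)
open import Data.Sum using (_⊎_)
open import Data.List using (List; []; _∷_; length)
open import Function using (_∘_; id)
open import Relation.Nullary using (yes; no)
open import Relation.Binary.PropositionalEquality using (_≡_)

-- X = {±1,…,±n}: (s , i) with i : Fin n stands for +(i+1) if s = true, −(i+1) if s = false.
X : ℕ → Set
X n = Bool × Fin n

neg : ∀ {n} → X n → X n
neg (s , i) = (not s , i)

record SignedPerm (n : ℕ) : Set where
  field
    fun     : X n → X n
    inv     : X n → X n
    inv-l   : ∀ x → inv (fun x) ≡ x
    inv-r   : ∀ x → fun (inv x) ≡ x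
    odd     : ∀ x → fun (neg x) ≡ neg (fun x)
open SignedPerm public

data Refl (n : ℕ) : Set where
  -- (i,j)(−i,−j), i < j
  swapPos : (i j : Fin n) → toℕ i < toℕ j → Refl n
  -- (i,−j)(−i,j), i < j
  swapNeg : (i j : Fin n) → toℕ i < toℕ j → Refl n
  -- (i,−i)
  flip    : (i : Fin n) → Refl n

reflFun : ∀ {n} → Refl n → X n → X n
reflFun (swapPos i j _) (s , k) with k ≟ i | k ≟ j
... | yes _ | _     = (s , j)
... | no _  | yes _ = (s , i)
... | no _  | no _  = (s , k)
reflFun (swapNeg i j _) (s , k) with k ≟ i | k ≟ j
... | yes _ | _     = (not s , j)
... | no _  | yes _ = (not s , i)
... | no _  | no _  = (s , k)
reflFun (flip i) (s , k) with k ≟ i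
... | yes _ = (not s , k)
... | no _  = (s , k)

wordFun : ∀ {n} → List (Refl n) → X n → X n
wordFun []       = id
wordFun (t ∷ ts) = reflFun t ∘ wordFun ts

ProductOf : ∀ {n} → (X n → X n) → ℕ → Set
ProductOf {n} f k = Σ (List (Refl n)) λ w → (length w ≡ k) × (∀ x → wordFun w x ≡ f x)

LengthB : ∀ {n} → SignedPerm n → ℕ → Set
LengthB τ k = ProductOf (fun τ) k × (∀ m → ProductOf (fun τ) m → k ≤ m)

divL : ∀ {n} → SignedPerm n → SignedPerm n → SignedPerm n
divL σ τ = record
  { fun   = inv σ ∘ fun τ
  ; inv   = inv τ ∘ fun σ
  ; inv-l = λ x → trans' (cong' (inv τ) (inv-r σ (fun τ x))) (inv-l τ x)
  ; inv-r = λ x → trans' (cong' (inv σ) (inv-r τ (fun σ x))) (inv-l σ x)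
  ; odd   = λ x → trans' (cong' (inv σ) (odd τ x)) (invOdd σ (fun τ x))
  }
  where
  open import Relation.Binary.PropositionalEquality using () renaming (trans to trans'; cong to cong'; sym to sym')
  invOdd : ∀ {n} (σ : SignedPerm n) y → inv σ (neg y) ≡ neg (inv σ y)
  invOdd σ y =
    trans' (sym' (inv-l σ (inv σ (neg y))))
      (trans' (cong' (inv σ) (trans' (inv-r σ (neg y))
                 (sym' (trans' (odd σ (inv σ y)) (cong' neg (inv-r σ y))))))
        (inv-l σ (neg (inv σ y))))

_≤B_ : ∀ {n} → SignedPerm n → SignedPerm n → Set
σ ≤B τ = ∃[ a ] ∃[ b ] ∃[ c ]
  (LengthB τ a × LengthB σ b × LengthB (divL σ τ) c × a ≡ b + c)

iter : ∀ {A : Set} → (A → A) → ℕ → A → A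
iter f ℕ.zero    = id
iter f (ℕ.suc k) = f ∘ iter f k

SameOrbit : ∀ {n} → SignedPerm n → X n → X n → Set
SameOrbit τ x y = ∃[ k ] iter (fun τ) k x ≡ y

-- Partitions of X are represented by their "same block" equivalence relations.
-- Ω̃(τ): orbits of τ, with all orbits A satisfying A = −A merged into one block.
-- (An orbit A of x satisfies A = −A iff −x ∈ A.)
SelfNeg : ∀ {n} → SignedPerm n → X n → Set
SelfNeg τ x = SameOrbit τ x (neg x)

OmegaT : ∀ {n} → SignedPerm n → X n → X n → Set
OmegaT τ x y = SameOrbit τ x y ⊎ (SelfNeg τ x × SelfNeg τ y)

-- reverse refinement: π ≤ ρ iff every block of ρ is a union of blocks of π,
-- i.e. any two elements in a common block of π are in a common block of ρ.
_≤P_ : ∀ {n} → (X n → X n → Set) → (X n → X n → Set) → Set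
_≤P_ {n} π ρ = ∀ (x y : X n) → π x y → ρ x y

module Submission where

-- Fold Ω̃(f) onto {0,1,…,n}: the point i stands for the pair ±i and 0 for the merged
-- self-negative block.  The number of classes of this folded partition, blocks f, is
-- 1 + the number of pairs {A, −A} of orbits with A ≠ −A, and ℓ_B(f) = n + 1 − blocks f.
--   * Counting: classes of a decidable equivalence relation on Fin m are counted by
--     their least elements; a coarser relation has fewer classes, a strictly coarser one
--     strictly fewer, and merging two classes loses at most one.
--   * One step (module Step): if the generator t swaps a ↔ b, the folded partition of
--     f·t is finer than that of f with |a| and |b| merged.  So blocks f ≤ 1 + blocks (f·t),
--     and in case of equality a and b share a block of Ω̃(f·t), whence Ω̃(f) refines
--     Ω̃(f·t).  Swapping a point with its image, on the other hand, adds a block.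
--   * Words: from the identity (n + 1 blocks) this gives ℓ_B(f) ≥ n + 1 − blocks f, and
--     splitting off points one at a time gives a factorization of that length.
--   * ℓ(σ) + ℓ(σ⁻¹τ) = ℓ(τ) then forces a word for σ⁻¹τ to drop one block per letter
--     from σ to τ, so Ω̃ only coarsens along it.

open import Defs
open import Data.Nat using (ℕ; zero; suc; _+_; _*_; _∸_; _≤_; _<_; s≤s; NonZero)
open import Data.Nat.Properties
open import Data.Nat.DivMod using (_%_; _/_; m≡m%n+[m/n]*n; m%n<n)
open import Data.Bool using (Bool; true; false; not; _xor_)
open import Data.Bool.Properties using (not-involutive) renaming (_≟_ to _≟B_)
open import Data.Fin as Fin using (Fin; toℕ; _↑ˡ_; _↑ʳ_; splitAt)
open import Data.Fin.Properties
  using (splitAt-↑ˡ; splitAt-↑ʳ; pigeonhole; toℕ<n; toℕ-fromℕ<; toℕ-injective; any?; all?; ¬∀⟶∃¬)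
  renaming (_≟_ to _≟F_; suc-injective to Fin-suc-injective)
open import Data.Fin.Subset using (Subset; _∈_; _∉_; _⊆_; ∣_∣; ⊤; inside; outside)
open import Data.Fin.Subset.Properties using (p⊆q⇒∣p∣≤∣q∣; p⊂q⇒∣p∣<∣q∣; ∣p∣≤n; ∣⊤∣≡n; ∣p∣≤∣x∷p∣; drop-there)
open import Data.Vec using (tabulate; here; there) renaming (_∷_ to _∷ᵥ_)
open import Data.List using (List; []; _∷_; length; _++_)
open import Data.List.Properties using (length-++)
open import Data.Vec.Properties using (lookup∘tabulate; []=⇒lookup; lookup⇒[]=)
open import Data.Product using (_×_; _,_; proj₁; proj₂; ∃; ∃-syntax)
open import Data.Product.Properties using (≡-dec)
open import Data.Sum using (_⊎_; inj₁; inj₂; [_,_])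
open import Data.Unit using (tt) renaming (⊤ to Unit)
open import Function using (_∘_; id)
open import Function.Definitions using (Injective)
open import Relation.Nullary using (Dec; yes; no; ¬_; does; proof; contradiction)
open import Relation.Nullary.Reflects using (Reflects; invert)
open import Relation.Nullary.Decidable using (map′; _×-dec_; _⊎-dec_; _→-dec_; ¬?; dec-true)
open import Relation.Binary.Core using (_⇒_)
open import Relation.Binary.Definitions using (Decidable; DecidableEquality; Tri; tri<; tri≈; tri>)
open import Relation.Binary.Structures using (IsEquivalence)
import Relation.Binary.Construct.On as On
open import Relation.Binary.PropositionalEquality hiding ([_])

negneg : ∀ {n} (x : X n) → neg (neg x) ≡ x
negneg (s , i) = cong (_, i) (not-involutive s)

neg≢ : ∀ {n} (x : X n) → neg x ≢ x
neg≢ (true , i) ()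
neg≢ (false , i) ()

_≟X_ : ∀ {n} → DecidableEquality (X n)
_≟X_ = ≡-dec _≟B_ _≟F_

-- |x| as an element of {1,…,n} ⊆ {0,1,…,n} = Fin (suc n)
index : ∀ {n} → X n → Fin (suc n)
index (_ , i) = Fin.suc i

same-index : ∀ {n} (z x : X n) → proj₂ z ≡ proj₂ x → z ≡ x ⊎ z ≡ neg x
same-index (true  , k) (true  , .k) refl = inj₁ refl
same-index (true  , k) (false , .k) refl = inj₂ refl
same-index (false , k) (true  , .k) refl = inj₂ refl
same-index (false , k) (false , .k) refl = inj₁ refl

encode : ∀ {n} → X n → Fin (n + n)
encode {n} (true  , i) = i ↑ˡ n
encode {n} (false , i) = n ↑ʳ i

decode : ∀ {n} → Fin (n + n) → X n
decode {n} k = [ (true ,_) , (false ,_) ] (splitAt n k)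

decode-encode : ∀ {n} (x : X n) → decode (encode x) ≡ x
decode-encode {n} (true  , i) = cong [ (true ,_) , (false ,_) ] (splitAt-↑ˡ n i n)
decode-encode {n} (false , i) = cong [ (true ,_) , (false ,_) ] (splitAt-↑ʳ n n i)

encode-injective : ∀ {n} → Injective _≡_ _≡_ (encode {n})
encode-injective {x = x} {y} e = trans (sym (decode-encode x)) (trans (cong decode e) (decode-encode y))

module _ {A : Set} (f : A → A) where

  iter-+ : ∀ k l x → iter f (k + l) x ≡ iter f k (iter f l x)
  iter-+ zero    l x = refl
  iter-+ (suc k) l x = cong f (iter-+ k l x)

  iter-suc : ∀ k x → iter f k (f x) ≡ iter f (suc k) x
  iter-suc zero    x = refl
  iter-suc (suc k) x = cong f (iter-suc k x)

  iter-fixed : ∀ {x} → f x ≡ x → ∀ k → iter f k x ≡ x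
  iter-fixed e zero    = refl
  iter-fixed e (suc k) = trans (cong f (iter-fixed e k)) e

  iter-periodic : ∀ {x} p → iter f p x ≡ x → ∀ m → iter f (m * p) x ≡ x
  iter-periodic p e zero    = refl
  iter-periodic {x} p e (suc m) = begin
    iter f (p + m * p) x      ≡⟨ iter-+ p (m * p) x ⟩
    iter f p (iter f (m * p) x) ≡⟨ cong (iter f p) (iter-periodic p e m) ⟩
    iter f p x                ≡⟨ e ⟩
    x                         ∎
    where open ≡-Reasoning

  iter-mod : ∀ {x} p .{{_ : NonZero p}} → iter f p x ≡ x → ∀ k → iter f k x ≡ iter f (k % p) x
  iter-mod {x} p e k = begin
    iter f k x                                ≡⟨ cong (λ m → iter f m x) (m≡m%n+[m/n]*n k p) ⟩
    iter f (k % p + (k / p) * p) x            ≡⟨ iter-+ (k % p) ((k / p) * p) x ⟩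
    iter f (k % p) (iter f ((k / p) * p) x)   ≡⟨ cong (iter f (k % p)) (iter-periodic p e (k / p)) ⟩
    iter f (k % p) x                          ∎
    where open ≡-Reasoning

iter-cong : ∀ {A : Set} {f g : A → A} → (∀ x → f x ≡ g x) → ∀ k x → iter f k x ≡ iter g k x
iter-cong e zero    x = refl
iter-cong {g = g} e (suc k) x = trans (e _) (cong g (iter-cong e k x))

Orb : ∀ {A : Set} → (A → A) → A → A → Set
Orb f x y = ∃[ k ] iter f k x ≡ y

module _ {A : Set} (f : A → A) where

  Orb-refl : ∀ {x} → Orb f x x
  Orb-refl = 0 , refl

  Orb-step : ∀ x → Orb f x (f x)
  Orb-step x = 1 , refl

  Orb-trans : ∀ {x y z} → Orb f x y → Orb f y z → Orb f x z
  Orb-trans (k , refl) (l , refl) = l + k , iter-+ f l k _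

  Orb-ind : (E : A → A → Set) → (∀ {x} → E x x) → (∀ {x y z} → E x y → E y z → E x z) →
            (∀ x → E x (f x)) → Orb f ⇒ E
  Orb-ind E r t st (zero  , refl) = r
  Orb-ind E r t st (suc k , refl) = t (Orb-ind E r t st (k , refl)) (st _)

Orb-cong : ∀ {A : Set} {f g : A → A} → (∀ x → f x ≡ g x) → Orb f ⇒ Orb g
Orb-cong e (k , p) = k , trans (sym (iter-cong e k _)) p

-- Signed maps: injective maps X → X commuting with x ↦ −x.  Being injective on a
-- finite set, they have periodic points, symmetric and decidable orbits.

record Signed {n} (f : X n → X n) : Set where
  field
    injective     : Injective _≡_ _≡_ f
    preserves-neg : ∀ x → f (neg x) ≡ neg (f x)
open Signed

Signed-id : ∀ {n} → Signed {n} id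
Signed-id = record { injective = id ; preserves-neg = λ _ → refl }

Signed-∘ : ∀ {n} {f g : X n → X n} → Signed f → Signed g → Signed (f ∘ g)
Signed-∘ {f = f} sf sg = record
  { injective     = injective sg ∘ injective sf
  ; preserves-neg = λ x → trans (cong f (preserves-neg sg x)) (preserves-neg sf _) }

Signed-perm : ∀ {n} (τ : SignedPerm n) → Signed (fun τ)
Signed-perm τ = record
  { injective     = λ {x} {y} e → trans (sym (inv-l τ x)) (trans (cong (inv τ) e) (inv-l τ y))
  ; preserves-neg = odd τ }

module _ {n} {f : X n → X n} (sf : Signed f) where

  iter-injective : ∀ k → Injective _≡_ _≡_ (iter f k)
  iter-injective zero    e = e
  iter-injective (suc k) e = iter-injective k (injective sf e)

  iter-neg : ∀ k x → iter f k (neg x) ≡ neg (iter f k x)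
  iter-neg zero    x = refl
  iter-neg (suc k) x = trans (cong f (iter-neg k x)) (preserves-neg sf _)

  period : ∀ x → ∃[ q ] suc q ≤ n + n × iter f (suc q) x ≡ x
  period x with pigeonhole (n<1+n (n + n)) (λ k → encode (iter f (toℕ k) x))
  ... | k , l , k<l , e with m≤n⇒∃[o]m+o≡n k<l
  ...   | q , k+1+q≡l = q , bound , iter-injective (toℕ k) returns
    where
    shift : toℕ k + suc q ≡ toℕ l
    shift = trans (+-suc (toℕ k) q) k+1+q≡l
    bound : suc q ≤ n + n
    bound = ≤-trans (m≤n+m (suc q) (toℕ k)) (≤-trans (≤-reflexive shift) (≤-pred (toℕ<n l)))
    returns : iter f (toℕ k) (iter f (suc q) x) ≡ iter f (toℕ k) x
    returns = begin
      iter f (toℕ k) (iter f (suc q) x) ≡⟨ sym (iter-+ f (toℕ k) (suc q) x) ⟩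
      iter f (toℕ k + suc q) x          ≡⟨ cong (λ m → iter f m x) shift ⟩
      iter f (toℕ l) x                  ≡⟨ encode-injective (sym e) ⟩
      iter f (toℕ k) x                  ∎
      where open ≡-Reasoning

  Orb-reduced : ∀ {x y} → Orb f x y →
                ∃[ q ] suc q ≤ n + n × iter f (suc q) x ≡ x × ∃[ r ] r < suc q × iter f r x ≡ y
  Orb-reduced {x} (k , e) with period x
  ... | q , q-bound , back =
    q , q-bound , back , k % suc q , m%n<n k (suc q) , trans (sym (iter-mod f (suc q) back k)) e

  Orb-sym : ∀ {x y} → Orb f x y → Orb f y x
  Orb-sym {x} o with Orb-reduced o
  ... | q , _ , back , r , r<p , refl = suc q ∸ r , (begin
    iter f (suc q ∸ r) (iter f r x) ≡⟨ sym (iter-+ f (suc q ∸ r) r x) ⟩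
    iter f (suc q ∸ r + r) x        ≡⟨ cong (λ m → iter f m x) (m∸n+n≡m (<⇒≤ r<p)) ⟩
    iter f (suc q) x                ≡⟨ back ⟩
    x                               ∎)
    where open ≡-Reasoning

  Orb-neg : ∀ {x y} → Orb f x y → Orb f (neg x) (neg y)
  Orb-neg (k , refl) = k , iter-neg k _

  Orb-isEquivalence : IsEquivalence (Orb f)
  Orb-isEquivalence = record { refl = Orb-refl f ; sym = Orb-sym ; trans = Orb-trans f }

  -- orbits are decidable: it suffices to search the first n + n iterates
  Orb? : Decidable (Orb f)
  Orb? x y = map′ (λ (k , e) → toℕ k , e) bounded (any? λ k → iter f (toℕ k) x ≟X y)
    where
    bounded : Orb f x y → ∃ λ (k : Fin (n + n)) → iter f (toℕ k) x ≡ y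
    bounded o with Orb-reduced o
    ... | q , q-bound , _ , r , r<p , e =
      Fin.fromℕ< r<n+n , trans (cong (λ m → iter f m x) (toℕ-fromℕ< r<n+n)) e
      where r<n+n = <-≤-trans r<p q-bound

module _ {n} (f : X n → X n) where

  SN : X n → Set
  SN x = Orb f x (neg x)

  Ω : X n → X n → Set
  Ω x y = Orb f x y ⊎ (SN x × SN y)

  Ω± : X n → X n → Set
  Ω± x y = Ω x y ⊎ Ω x (neg y)

  -- Ω̃ folded onto {0,1,…,n}: the point i stands for the pair ±i and 0 for the
  -- merged self-negative block, so the blocks are {0} ∪ (self-negative indices)
  -- and one block for each pair {A, −A} of orbits with A ≠ −A
  Folded : Fin (suc n) → Fin (suc n) → Set
  Folded Fin.zero    Fin.zero    = Unit
  Folded Fin.zero    (Fin.suc j) = SN (true , j)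
  Folded (Fin.suc i) Fin.zero    = SN (true , i)
  Folded (Fin.suc i) (Fin.suc j) = Ω± (true , i) (true , j)

module _ {n} {f : X n → X n} (sf : Signed f) where

  private
    module O = IsEquivalence (Orb-isEquivalence sf)

  SN-neg : ∀ {x} → SN f x → SN f (neg x)
  SN-neg = Orb-neg sf

  SN-orb : ∀ {x y} → Orb f x y → SN f y → SN f x
  SN-orb o s = O.trans o (O.trans s (Orb-neg sf (O.sym o)))

  Ω-isEquivalence : IsEquivalence (Ω f)
  Ω-isEquivalence = record { refl = inj₁ O.refl ; sym = Ω-sym ; trans = Ω-trans }
    where
    Ω-sym : ∀ {x y} → Ω f x y → Ω f y x
    Ω-sym (inj₁ o)       = inj₁ (O.sym o)
    Ω-sym (inj₂ (p , q)) = inj₂ (q , p)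
    Ω-trans : ∀ {x y z} → Ω f x y → Ω f y z → Ω f x z
    Ω-trans (inj₁ o)       (inj₁ o')        = inj₁ (O.trans o o')
    Ω-trans (inj₁ o)       (inj₂ (p , q))   = inj₂ (SN-orb o p , q)
    Ω-trans (inj₂ (p , q)) (inj₁ o')        = inj₂ (p , SN-orb (O.sym o') q)
    Ω-trans (inj₂ (p , _)) (inj₂ (_ , q'))  = inj₂ (p , q')

  private
    module Ωₑ = IsEquivalence Ω-isEquivalence

  Ω-neg : ∀ {x y} → Ω f x y → Ω f (neg x) (neg y)
  Ω-neg (inj₁ o)       = inj₁ (Orb-neg sf o)
  Ω-neg (inj₂ (p , q)) = inj₂ (SN-neg p , SN-neg q)

  Ω-SN : ∀ {x y} → Ω f x y → SN f x → SN f y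
  Ω-SN (inj₁ o)       s = SN-orb (O.sym o) s
  Ω-SN (inj₂ (_ , q)) s = q

  Ω? : Decidable (Ω f)
  Ω? x y = Orb? sf x y ⊎-dec (Orb? sf x (neg x) ×-dec Orb? sf y (neg y))

  Ω±-isEquivalence : IsEquivalence (Ω± f)
  Ω±-isEquivalence = record { refl = inj₁ Ωₑ.refl ; sym = Ω±-sym ; trans = Ω±-trans }
    where
    Ω±-sym : ∀ {x y} → Ω± f x y → Ω± f y x
    Ω±-sym (inj₁ p) = inj₁ (Ωₑ.sym p)
    Ω±-sym {x} (inj₂ p) = inj₂ (subst (λ u → Ω f u (neg x)) (negneg _) (Ω-neg (Ωₑ.sym p)))
    Ω±-trans : ∀ {x y z} → Ω± f x y → Ω± f y z → Ω± f x z
    Ω±-trans (inj₁ p) (inj₁ q) = inj₁ (Ωₑ.trans p q)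
    Ω±-trans (inj₁ p) (inj₂ q) = inj₂ (Ωₑ.trans p q)
    Ω±-trans (inj₂ p) (inj₁ q) = inj₂ (Ωₑ.trans p (Ω-neg q))
    Ω±-trans (inj₂ p) (inj₂ q) = inj₁ (Ωₑ.trans p (subst (Ω f _) (negneg _) (Ω-neg q)))

  private
    module Ω±ₑ = IsEquivalence Ω±-isEquivalence

  Ω±-negʳ : ∀ {x y} → Ω± f x y → Ω± f x (neg y)
  Ω±-negʳ (inj₁ p) = inj₂ (subst (Ω f _) (sym (negneg _)) p)
  Ω±-negʳ (inj₂ p) = inj₁ p

  Ω±-negˡ : ∀ {x y} → Ω± f x y → Ω± f (neg x) y
  Ω±-negˡ = Ω±ₑ.sym ∘ Ω±-negʳ ∘ Ω±ₑ.sym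

  Ω±-SN : ∀ {x y} → Ω± f x y → SN f x → SN f y
  Ω±-SN (inj₁ p) s = Ω-SN p s
  Ω±-SN (inj₂ p) s = subst (SN f) (negneg _) (SN-neg (Ω-SN p s))

  Folded-isEquivalence : IsEquivalence (Folded f)
  Folded-isEquivalence = record { refl = F-refl ; sym = F-sym ; trans = F-trans }
    where
    F-refl : ∀ {u} → Folded f u u
    F-refl {Fin.zero}  = tt
    F-refl {Fin.suc i} = Ω±ₑ.refl
    F-sym : ∀ {u v} → Folded f u v → Folded f v u
    F-sym {Fin.zero}  {Fin.zero}  p = p
    F-sym {Fin.zero}  {Fin.suc j} p = p
    F-sym {Fin.suc i} {Fin.zero}  p = p
    F-sym {Fin.suc i} {Fin.suc j} p = Ω±ₑ.sym p
    F-trans : ∀ {u v w} → Folded f u v → Folded f v w → Folded f u w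
    F-trans {Fin.zero}  {Fin.zero}  {w}         _ q = q
    F-trans {Fin.zero}  {Fin.suc j} {Fin.zero}  _ _ = tt
    F-trans {Fin.zero}  {Fin.suc j} {Fin.suc k} p q = Ω±-SN q p
    F-trans {Fin.suc i} {Fin.zero}  {Fin.zero}  p _ = p
    F-trans {Fin.suc i} {Fin.zero}  {Fin.suc k} p q = inj₁ (inj₂ (p , q))
    F-trans {Fin.suc i} {Fin.suc j} {Fin.zero}  p q = Ω±-SN (Ω±ₑ.sym p) q
    F-trans {Fin.suc i} {Fin.suc j} {Fin.suc k} p q = Ω±ₑ.trans p q

  Folded? : Decidable (Folded f)
  Folded? Fin.zero    Fin.zero    = yes tt
  Folded? Fin.zero    (Fin.suc j) = Orb? sf _ _
  Folded? (Fin.suc i) Fin.zero    = Orb? sf _ _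
  Folded? (Fin.suc i) (Fin.suc j) = Ω? _ _ ⊎-dec Ω? _ _

  Folded-index : ∀ {x y} → Ω± f x y → Folded f (index x) (index y)
  Folded-index {true  , i} {true  , j} p = p
  Folded-index {true  , i} {false , j} p = Ω±-negʳ p
  Folded-index {false , i} {true  , j} p = Ω±-negˡ p
  Folded-index {false , i} {false , j} p = Ω±-negˡ (Ω±-negʳ p)

  Folded-index⁻ : ∀ {x y} → Folded f (index x) (index y) → Ω± f x y
  Folded-index⁻ {true  , i} {true  , j} p = p
  Folded-index⁻ {true  , i} {false , j} p = Ω±-negʳ p
  Folded-index⁻ {false , i} {true  , j} p = Ω±-negˡ p
  Folded-index⁻ {false , i} {false , j} p = Ω±-negˡ (Ω±-negʳ p)

  Folded-zero : ∀ {x} → SN f x → Folded f Fin.zero (index x)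
  Folded-zero {true  , i} s = s
  Folded-zero {false , i} s = SN-neg s

  Folded-zero⁻ : ∀ {x} → Folded f Fin.zero (index x) → SN f x
  Folded-zero⁻ {true  , i} s = s
  Folded-zero⁻ {false , i} s = SN-neg s

-- The classes of a decidable equivalence relation on Fin m are counted by their
-- least elements (leaders).

∣p∣≤1+∣q∣ : ∀ {m} (p q : Subset m) (y₀ : Fin m) → (∀ {y} → y ∈ p → y ≢ y₀ → y ∈ q) →
            ∣ p ∣ ≤ suc ∣ q ∣
∣p∣≤1+∣q∣ (s ∷ᵥ p) (s' ∷ᵥ q) Fin.zero h = ≤-trans (∣x∷p∣≤1+∣p∣ s p) (s≤s (≤-trans tail (∣p∣≤∣x∷p∣ s' q)))
  where
  ∣x∷p∣≤1+∣p∣ : ∀ {m} s (p : Subset m) → ∣ s ∷ᵥ p ∣ ≤ suc ∣ p ∣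
  ∣x∷p∣≤1+∣p∣ inside  p = ≤-refl
  ∣x∷p∣≤1+∣p∣ outside p = n≤1+n _
  tail : ∣ p ∣ ≤ ∣ q ∣
  tail = p⊆q⇒∣p∣≤∣q∣ λ y∈p → drop-there (h (there y∈p) (λ ()))
∣p∣≤1+∣q∣ (outside ∷ᵥ p) (s' ∷ᵥ q) (Fin.suc y₀) h =
  ≤-trans (∣p∣≤1+∣q∣ p q y₀ λ y∈p y≢y₀ → drop-there (h (there y∈p) (y≢y₀ ∘ Fin-suc-injective)))
          (s≤s (∣p∣≤∣x∷p∣ s' q))
∣p∣≤1+∣q∣ (inside ∷ᵥ p) (s' ∷ᵥ q) (Fin.suc y₀) h with h here (λ ())
... | here = s≤s (∣p∣≤1+∣q∣ p q y₀ λ y∈p y≢y₀ → drop-there (h (there y∈p) (y≢y₀ ∘ Fin-suc-injective)))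

least : ∀ {m} {P : Fin m → Set} → (∀ y → Dec (P y)) → ∀ {x} → P x →
        ∃[ y ] P y × (∀ z → toℕ z < toℕ y → ¬ P z)
least {suc m} P? {x} px with P? Fin.zero
... | yes p0 = Fin.zero , p0 , λ z ()
least {suc m} P? {Fin.zero}  px | no ¬p0 = contradiction px ¬p0
least {suc m} P? {Fin.suc x} px | no ¬p0 with least (P? ∘ Fin.suc) px
... | y , py , minimal = Fin.suc y , py , λ { Fin.zero _ → ¬p0 ; (Fin.suc z) (s≤s z<y) → minimal z z<y }

least-ℕ : ∀ {P : ℕ → Set} → (∀ m → Dec (P m)) → ∀ {k} → P k → ∃[ m ] P m × (∀ m' → m' < m → ¬ P m')
least-ℕ P? {zero} p = zero , p , λ _ ()
least-ℕ P? {suc k} p with P? zero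
... | yes p0 = zero , p0 , λ _ ()
... | no ¬p0 with least-ℕ (P? ∘ suc) p
...   | m , pm , minimal = suc m , pm , λ { zero _ → ¬p0 ; (suc m') (s≤s m'<m) → minimal m' m'<m }

module _ {m : ℕ} where

  Leader : (Fin m → Fin m → Set) → Fin m → Set
  Leader R y = ∀ x → toℕ x < toℕ y → ¬ R x y

  module _ {R : Fin m → Fin m → Set} where

    leader? : Decidable R → ∀ y → Dec (Leader R y)
    leader? R? y = all? λ x → (toℕ x <? toℕ y) →-dec ¬? (R? x y)

    leaders : Decidable R → Subset m
    leaders R? = tabulate λ y → does (leader? R? y)

    classes : Decidable R → ℕ
    classes R? = ∣ leaders R? ∣

    ∈leaders⁺ : (R? : Decidable R) → ∀ {y} → Leader R y → y ∈ leaders R?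
    ∈leaders⁺ R? {y} ly =
      lookup⇒[]= y (leaders R?) (trans (lookup∘tabulate _ y) (dec-true (leader? R? y) ly))

    ∈leaders⁻ : (R? : Decidable R) → ∀ {y} → y ∈ leaders R? → Leader R y
    ∈leaders⁻ R? {y} y∈ = invert (subst (Reflects _) is-true (proof (leader? R? y)))
      where
      is-true : does (leader? R? y) ≡ true
      is-true = trans (sym (lookup∘tabulate _ y)) ([]=⇒lookup y∈)

    classes-≤ : (R? : Decidable R) → classes R? ≤ m
    classes-≤ R? = ∣p∣≤n (leaders R?)

    module _ (R-equiv : IsEquivalence R) where
      private module Rₑ = IsEquivalence R-equiv

      leader-of : Decidable R → ∀ x → ∃[ y ] Leader R y × R y x
      leader-of R? x with least (λ y → R? y x) Rₑ.refl
      ... | y , ryx , minimal = y , (λ z z<y rzy → minimal z z<y (Rₑ.trans rzy ryx)) , ryx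

      leader-least : ∀ {x y} → Leader R y → R x y → toℕ y ≤ toℕ x
      leader-least {x} ly rxy = ≮⇒≥ λ x<y → ly x x<y rxy

      leader-unique : ∀ {y y'} → Leader R y → Leader R y' → R y y' → y ≡ y'
      leader-unique {y} {y'} ly ly' r with <-cmp (toℕ y) (toℕ y')
      ... | tri< y<y' _ _ = contradiction r (ly' y y<y')
      ... | tri≈ _ e _    = toℕ-injective e
      ... | tri> _ _ y'<y = contradiction (Rₑ.sym r) (ly y' y'<y)

  module _ {R S : Fin m → Fin m → Set} (R? : Decidable R) (S? : Decidable S) (R⇒S : R ⇒ S) where

    leaders-anti : leaders S? ⊆ leaders R?
    leaders-anti y∈ = ∈leaders⁺ R? λ x x<y → ∈leaders⁻ S? y∈ x x<y ∘ R⇒S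

    classes-anti : classes S? ≤ classes R?
    classes-anti = p⊆q⇒∣p∣≤∣q∣ leaders-anti

    classes-strict : IsEquivalence R → IsEquivalence S → ∀ {x y} → S x y → ¬ R x y →
                     classes S? < classes R?
    classes-strict R-equiv S-equiv {x} {y} sxy ¬rxy
      with leader-of R-equiv R? x | leader-of R-equiv R? y
    ... | lx , Llx , rlx | ly , Lly , rly = p⊂q⇒∣p∣<∣q∣ (leaders-anti , witness (<-cmp (toℕ lx) (toℕ ly)))
      where
      module Rₑ = IsEquivalence R-equiv
      module Sₑ = IsEquivalence S-equiv
      slxly : S lx ly
      slxly = Sₑ.trans (R⇒S rlx) (Sₑ.trans sxy (Sₑ.sym (R⇒S rly)))
      not-S-leader : ∀ {u v} → toℕ u < toℕ v → S u v → v ∉ leaders S?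
      not-S-leader {u} u<v suv v∈ = ∈leaders⁻ S? v∈ u u<v suv
      witness : Tri (toℕ lx < toℕ ly) (toℕ lx ≡ toℕ ly) (toℕ ly < toℕ lx) → ∃ λ z → z ∈ leaders R? × z ∉ leaders S?
      witness (tri< lx<ly _ _) = ly , ∈leaders⁺ R? Lly , not-S-leader lx<ly slxly
      witness (tri≈ _ e _)     = contradiction (Rₑ.trans (Rₑ.sym rlx) (subst (λ u → R u y) (sym (toℕ-injective e)) rly)) ¬rxy
      witness (tri> _ _ ly<lx) = lx , ∈leaders⁺ R? Llx , not-S-leader ly<lx (Sₑ.sym slxly)

  classes-discrete : ∀ {R : Fin m → Fin m → Set} (R? : Decidable R) → (∀ {x y} → R x y → x ≡ y) →
                     classes R? ≡ m
  classes-discrete {R} R? discrete = ≤-antisym (classes-≤ R?) (begin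
    m                ≡⟨ sym (∣⊤∣≡n m) ⟩
    ∣ ⊤ {m} ∣        ≤⟨ p⊆q⇒∣p∣≤∣q∣ {p = ⊤} (λ {y} _ → ∈leaders⁺ R? λ x x<y rxy → <-irrefl (cong toℕ (discrete rxy)) x<y) ⟩
    classes R?       ∎)
    where open ≤-Reasoning

  Join : (Fin m → Fin m → Set) → Fin m → Fin m → Fin m → Fin m → Set
  Join R a b x y = R x y ⊎ (R x a × R b y) ⊎ (R x b × R a y)

  module _ {R : Fin m → Fin m → Set} (R? : Decidable R) (R-equiv : IsEquivalence R) (a b : Fin m) where
    private module Rₑ = IsEquivalence R-equiv

    Join? : Decidable (Join R a b)
    Join? x y = R? x y ⊎-dec ((R? x a ×-dec R? b y) ⊎-dec (R? x b ×-dec R? a y))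

    Join-isEquivalence : IsEquivalence (Join R a b)
    Join-isEquivalence = record { refl = inj₁ Rₑ.refl ; sym = J-sym ; trans = J-trans }
      where
      J-sym : ∀ {x y} → Join R a b x y → Join R a b y x
      J-sym (inj₁ r)                = inj₁ (Rₑ.sym r)
      J-sym (inj₂ (inj₁ (p , q)))   = inj₂ (inj₂ (Rₑ.sym q , Rₑ.sym p))
      J-sym (inj₂ (inj₂ (p , q)))   = inj₂ (inj₁ (Rₑ.sym q , Rₑ.sym p))
      J-trans : ∀ {x y z} → Join R a b x y → Join R a b y z → Join R a b x z
      J-trans (inj₁ p) (inj₁ q)                           = inj₁ (Rₑ.trans p q)
      J-trans (inj₁ p) (inj₂ (inj₁ (q₁ , q₂)))            = inj₂ (inj₁ (Rₑ.trans p q₁ , q₂))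
      J-trans (inj₁ p) (inj₂ (inj₂ (q₁ , q₂)))            = inj₂ (inj₂ (Rₑ.trans p q₁ , q₂))
      J-trans (inj₂ (inj₁ (p₁ , p₂))) (inj₁ q)            = inj₂ (inj₁ (p₁ , Rₑ.trans p₂ q))
      J-trans (inj₂ (inj₂ (p₁ , p₂))) (inj₁ q)            = inj₂ (inj₂ (p₁ , Rₑ.trans p₂ q))
      J-trans (inj₂ (inj₁ (p₁ , p₂))) (inj₂ (inj₁ (q₁ , q₂))) =
        inj₁ (Rₑ.trans p₁ (Rₑ.trans (Rₑ.sym (Rₑ.trans p₂ q₁)) q₂))
      J-trans (inj₂ (inj₁ (p₁ , _)))  (inj₂ (inj₂ (_ , q₂)))  = inj₁ (Rₑ.trans p₁ q₂)
      J-trans (inj₂ (inj₂ (p₁ , _)))  (inj₂ (inj₁ (_ , q₂)))  = inj₁ (Rₑ.trans p₁ q₂)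
      J-trans (inj₂ (inj₂ (p₁ , p₂))) (inj₂ (inj₂ (q₁ , q₂))) =
        inj₁ (Rₑ.trans p₁ (Rₑ.trans (Rₑ.sym (Rₑ.trans p₂ q₁)) q₂))

    -- merging two classes removes at most one class: every leader of R other than
    -- the larger of the leaders of a and b is still a leader of the join
    classes-join : classes R? ≤ suc (classes Join?)
    classes-join with leader-of R-equiv R? a | leader-of R-equiv R? b
    ... | la , Lla , rla | lb , Llb , rlb =
      ∣p∣≤1+∣q∣ (leaders R?) (leaders Join?) larger λ y∈ y≢ → ∈leaders⁺ Join? (still-leader (∈leaders⁻ R? y∈) y≢)
      where
      larger : Fin m
      larger with toℕ la ≤? toℕ lb
      ... | yes _ = lb
      ... | no _  = la
      larger-b : toℕ la < toℕ lb → larger ≡ lb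
      larger-b la<lb with toℕ la ≤? toℕ lb
      ... | yes _   = refl
      ... | no la≰lb = contradiction (<⇒≤ la<lb) la≰lb
      larger-a : toℕ lb < toℕ la → larger ≡ la
      larger-a lb<la with toℕ la ≤? toℕ lb
      ... | yes la≤lb = contradiction la≤lb (<⇒≱ lb<la)
      ... | no _      = refl
      through-merge : ∀ {u v lu lv x y} → Leader R lu → R lu u → Leader R lv → R lv v →
                      Leader R y → toℕ x < toℕ y → R x u → R v y → toℕ lu < toℕ lv × lv ≡ y
      through-merge {lu = lu} Llu rlu Llv rlv Ly x<y rxu rvy =
        subst (λ w → toℕ lu < toℕ w) (sym lv≡y) (≤-<-trans (leader-least R-equiv Llu (Rₑ.trans rxu (Rₑ.sym rlu))) x<y) , lv≡y
        where lv≡y = leader-unique R-equiv Llv Ly (Rₑ.trans rlv rvy)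
      still-leader : ∀ {y} → Leader R y → y ≢ larger → Leader (Join R a b) y
      still-leader Ly y≢ x x<y (inj₁ rxy) = Ly x x<y rxy
      still-leader Ly y≢ x x<y (inj₂ (inj₁ (rxa , rby))) with through-merge Lla rla Llb rlb Ly x<y rxa rby
      ... | la<lb , lb≡y = y≢ (trans (sym lb≡y) (sym (larger-b la<lb)))
      still-leader Ly y≢ x x<y (inj₂ (inj₂ (rxb , ray))) with through-merge Llb rlb Lla rla Ly x<y rxb ray
      ... | lb<la , la≡y = y≢ (trans (sym la≡y) (sym (larger-a lb<la)))

record Swap {n} (h : X n → X n) (a b : X n) : Set where
  field
    involution : ∀ z → h (h z) ≡ z
    commutes   : ∀ z → h (neg z) ≡ neg (h z)
    sends      : h a ≡ b
    fixes      : ∀ z → proj₂ z ≢ proj₂ a → proj₂ z ≢ proj₂ b → h z ≡ z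
open Swap

module _ {n} {h : X n → X n} {a b : X n} (sw : Swap h a b) where

  Swap-signed : Signed h
  Swap-signed = record
    { injective     = λ {x} {y} e → trans (sym (involution sw x)) (trans (cong h e) (involution sw y))
    ; preserves-neg = commutes sw }

  sends-back : ∀ {u v} → h u ≡ v → h v ≡ u
  sends-back {u} e = trans (cong h (sym e)) (involution sw u)

  Swap-sym : Swap h b a
  Swap-sym = record
    { involution = involution sw ; commutes = commutes sw
    ; sends = sends-back (sends sw) ; fixes = λ z z≢b z≢a → fixes sw z z≢a z≢b }

  Swap-neg : Swap h (neg a) (neg b)
  Swap-neg = record
    { involution = involution sw ; commutes = commutes sw
    ; sends = trans (commutes sw a) (cong neg (sends sw)) ; fixes = fixes sw }

  data Moves : X n → Set where
    fixed : ∀ {z} → h z ≡ z → Moves z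
    at-a  : Moves a
    at-b  : Moves b
    at-−a : Moves (neg a)
    at-−b : Moves (neg b)

  moves : ∀ z → Moves z
  moves z with proj₂ z ≟F proj₂ a | proj₂ z ≟F proj₂ b
  ... | yes z~a | _ with same-index z a z~a
  ...   | inj₁ refl = at-a
  ...   | inj₂ refl = at-−a
  moves z | no z≁a | yes z~b with same-index z b z~b
  ...   | inj₁ refl = at-b
  ...   | inj₂ refl = at-−b
  moves z | no z≁a | no z≁b = fixed (fixes sw z z≁a z≁b)

  related-to-swap : {E : X n → X n → Set} → IsEquivalence E → E a b → E (neg a) (neg b) → ∀ z → E z (h z)
  related-to-swap {E} E-equiv eab e−a−b z = go (moves z)
    where
    module Eₑ = IsEquivalence E-equiv
    go : ∀ {z} → Moves z → E z (h z)
    go (fixed e) = subst (E _) (sym e) Eₑ.refl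
    go at-a      = subst (E a) (sym (sends sw)) eab
    go at-b      = subst (E b) (sym (sends-back (sends sw))) (Eₑ.sym eab)
    go at-−a     = subst (E (neg a)) (sym (sends Swap-neg)) e−a−b
    go at-−b     = subst (E (neg b)) (sym (sends-back (sends Swap-neg))) (Eₑ.sym e−a−b)

  orbits-after-swap : ∀ {f : X n → X n} {E : X n → X n → Set} → IsEquivalence E →
                      Orb f ⇒ E → E a b → E (neg a) (neg b) → Orb (f ∘ h) ⇒ E
  orbits-after-swap {f} {E} E-equiv f⇒E eab e−a−b =
    Orb-ind (f ∘ h) E Eₑ.refl Eₑ.trans λ z → Eₑ.trans (related-to-swap E-equiv eab e−a−b z) (f⇒E (Orb-step f (h z)))
    where module Eₑ = IsEquivalence E-equiv

xor-involutive : ∀ c s → c xor (c xor s) ≡ s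
xor-involutive true  s = not-involutive s
xor-involutive false s = refl

xor-not : ∀ c s → c xor not s ≡ not (c xor s)
xor-not true  s = refl
xor-not false s = refl

swapMap : ∀ {n} → Bool → Fin n → Fin n → X n → X n
swapMap c i j (s , k) with k ≟F i | k ≟F j
... | yes _ | _     = (c xor s , j)
... | no _  | yes _ = (c xor s , i)
... | no _  | no _  = (s , k)

module _ {n} (c : Bool) (i j : Fin n) where

  swapMap-i : ∀ s → swapMap c i j (s , i) ≡ (c xor s , j)
  swapMap-i s with i ≟F i
  ... | yes _  = refl
  ... | no i≢i = contradiction refl i≢i

  swapMap-j : ∀ s → swapMap c i j (s , j) ≡ (c xor s , i)
  swapMap-j s with j ≟F i | j ≟F j
  ... | yes refl | _   = refl
  ... | no _ | yes _   = refl
  ... | no _ | no j≢j  = contradiction refl j≢j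

  swapMap-rest : ∀ s {k} → k ≢ i → k ≢ j → swapMap c i j (s , k) ≡ (s , k)
  swapMap-rest s {k} k≢i k≢j with k ≟F i | k ≟F j
  ... | yes k≡i | _     = contradiction k≡i k≢i
  ... | no _ | yes k≡j  = contradiction k≡j k≢j
  ... | no _ | no _     = refl

  swapMap-involutive-at : ∀ s k → Dec (k ≡ i) → Dec (k ≡ j) → swapMap c i j (swapMap c i j (s , k)) ≡ (s , k)
  swapMap-involutive-at s k (yes refl) _ =
    trans (cong (swapMap c i j) (swapMap-i s)) (trans (swapMap-j _) (cong (_, k) (xor-involutive c s)))
  swapMap-involutive-at s k (no _) (yes refl) =
    trans (cong (swapMap c i j) (swapMap-j s)) (trans (swapMap-i _) (cong (_, k) (xor-involutive c s)))
  swapMap-involutive-at s k (no k≢i) (no k≢j) =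
    trans (cong (swapMap c i j) (swapMap-rest s k≢i k≢j)) (swapMap-rest s k≢i k≢j)

  swapMap-swap : Swap (swapMap c i j) (true , i) (c xor true , j)
  swapMap-swap = record
    { involution = involutive ; commutes = commutes′ ; sends = swapMap-i true
    ; fixes = λ (s , k) k≢i k≢j → swapMap-rest s k≢i k≢j }
    where
    involutive : ∀ z → swapMap c i j (swapMap c i j z) ≡ z
    involutive (s , k) = swapMap-involutive-at s k (k ≟F i) (k ≟F j)
    commutes′ : ∀ z → swapMap c i j (neg z) ≡ neg (swapMap c i j z)
    commutes′ (s , k) with k ≟F i | k ≟F j
    ... | yes _ | _     = cong (_, j) (xor-not c s)
    ... | no _  | yes _ = cong (_, i) (xor-not c s)
    ... | no _  | no _  = refl

Swap-cong : ∀ {n} {h h' : X n → X n} {a b} → (∀ z → h z ≡ h' z) → Swap h' a b → Swap h a b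
Swap-cong {h = h} {h'} e sw = record
  { involution = λ z → trans (cong h (e z)) (trans (e _) (involution sw z))
  ; commutes   = λ z → trans (e _) (trans (commutes sw z) (cong neg (sym (e z))))
  ; sends      = trans (e _) (sends sw)
  ; fixes      = λ z p q → trans (e z) (fixes sw z p q) }

reflection-swap : ∀ {n} (t : Refl n) → ∃[ a ] ∃[ b ] Swap (reflFun t) a b
reflection-swap (swapPos i j i<j) = _ , _ , Swap-cong agrees (swapMap-swap false i j)
  where
  agrees : ∀ z → reflFun (swapPos i j i<j) z ≡ swapMap false i j z
  agrees (s , k) with k ≟F i | k ≟F j
  ... | yes _ | _     = refl
  ... | no _  | yes _ = refl
  ... | no _  | no _  = refl
reflection-swap (swapNeg i j i<j) = _ , _ , Swap-cong agrees (swapMap-swap true i j)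
  where
  agrees : ∀ z → reflFun (swapNeg i j i<j) z ≡ swapMap true i j z
  agrees (s , k) with k ≟F i | k ≟F j
  ... | yes _ | _     = refl
  ... | no _  | yes _ = refl
  ... | no _  | no _  = refl
reflection-swap (flip i) = _ , _ , Swap-cong agrees (swapMap-swap true i i)
  where
  agrees : ∀ z → reflFun (flip i) z ≡ swapMap true i i z
  agrees (s , k) with k ≟F i
  ... | yes refl = refl
  ... | no _     = refl

swap-reflection : ∀ {n} (i : Fin n) (y : X n) → (true , i) ≢ y → ∃[ t ] Swap (reflFun t) (true , i) y
swap-reflection i (s , j) i≢y with <-cmp (toℕ i) (toℕ j)
swap-reflection i (true  , j) i≢y | tri< i<j _ _ = swapPos i j i<j , proj₂ (proj₂ (reflection-swap (swapPos i j i<j)))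
swap-reflection i (false , j) i≢y | tri< i<j _ _ = swapNeg i j i<j , proj₂ (proj₂ (reflection-swap (swapNeg i j i<j)))
swap-reflection i (true  , j) i≢y | tri≈ _ i≡j _ = contradiction (cong (true ,_) (toℕ-injective i≡j)) i≢y
swap-reflection i (false , j) i≢y | tri≈ _ i≡j _ with toℕ-injective i≡j
... | refl = flip i , proj₂ (proj₂ (reflection-swap (flip i)))
swap-reflection i (true  , j) i≢y | tri> _ _ j<i =
  swapPos j i j<i , Swap-sym (proj₂ (proj₂ (reflection-swap (swapPos j i j<i))))
swap-reflection i (false , j) i≢y | tri> _ _ j<i =
  swapNeg j i j<i , Swap-sym (Swap-neg (proj₂ (proj₂ (reflection-swap (swapNeg j i j<i)))))

record SignedMap (n : ℕ) : Set where
  field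
    ⟦_⟧    : X n → X n
    signed : Signed ⟦_⟧
open SignedMap

-- the number of blocks of the folded partition, i.e. 1 + the number of pairs {A, −A}
-- of orbits with A ≠ −A
blocks : ∀ {n} → SignedMap n → ℕ
blocks s = classes (Folded? (signed s))

Ω-mono : ∀ {n} {f g : X n → X n} → Orb f ⇒ Orb g → Ω f ⇒ Ω g
Ω-mono f⇒g (inj₁ o)       = inj₁ (f⇒g o)
Ω-mono f⇒g (inj₂ (p , q)) = inj₂ (f⇒g p , f⇒g q)

Folded-mono : ∀ {n} {f g : X n → X n} → Orb f ⇒ Orb g → Folded f ⇒ Folded g
Folded-mono f⇒g {Fin.zero} {Fin.zero} p        = p
Folded-mono f⇒g {Fin.zero} {Fin.suc _} p        = f⇒g p
Folded-mono f⇒g {Fin.suc _} {Fin.zero} p        = f⇒g p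
Folded-mono f⇒g {Fin.suc _} {Fin.suc _} (inj₁ p) = inj₁ (Ω-mono f⇒g p)
Folded-mono f⇒g {Fin.suc _} {Fin.suc _} (inj₂ p) = inj₂ (Ω-mono f⇒g p)

blocks-cong : ∀ {n} (s s' : SignedMap n) → (∀ x → ⟦ s ⟧ x ≡ ⟦ s' ⟧ x) → blocks s ≡ blocks s'
blocks-cong s s' e = ≤-antisym
  (classes-anti (Folded? (signed s')) (Folded? (signed s)) (Folded-mono (Orb-cong (sym ∘ e))))
  (classes-anti (Folded? (signed s)) (Folded? (signed s')) (Folded-mono (Orb-cong e)))

identity : ∀ {n} → SignedMap n
identity = record { ⟦_⟧ = id ; signed = Signed-id }

-- the identity has n + 1 blocks: its orbits are singletons, none of them self-negative
blocks-identity : ∀ {n} → blocks (identity {n}) ≡ suc n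
blocks-identity {n} = classes-discrete (Folded? Signed-id) discrete
  where
  orbit-trivial : ∀ {x y : X n} → Orb id x y → y ≡ x
  orbit-trivial (k , refl) = iter-fixed id refl k
  not-SN : ∀ {x : X n} → ¬ SN id x
  not-SN o = neg≢ _ (orbit-trivial o)
  discrete : ∀ {u v} → Folded id u v → u ≡ v
  discrete {Fin.zero}  {Fin.zero}  _ = refl
  discrete {Fin.zero}  {Fin.suc _} s = contradiction s not-SN
  discrete {Fin.suc _} {Fin.zero}  s = contradiction s not-SN
  discrete {Fin.suc _} {Fin.suc _} (inj₁ (inj₁ o))       = cong index (sym (orbit-trivial o))
  discrete {Fin.suc _} {Fin.suc _} (inj₁ (inj₂ (s , _))) = contradiction s not-SN
  discrete {Fin.suc _} {Fin.suc _} (inj₂ (inj₁ o))       = contradiction (orbit-trivial o) λ ()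
  discrete {Fin.suc _} {Fin.suc _} (inj₂ (inj₂ (s , _))) = contradiction s not-SN

permutation : ∀ {n} → SignedPerm n → SignedMap n
permutation τ = record { ⟦_⟧ = fun τ ; signed = Signed-perm τ }

_·_ : ∀ {n} → SignedMap n → Refl n → SignedMap n
s · t = record { ⟦_⟧ = ⟦ s ⟧ ∘ reflFun t
               ; signed = Signed-∘ (signed s) (Swap-signed (proj₂ (proj₂ (reflection-swap t)))) }

_·*_ : ∀ {n} → SignedMap n → List (Refl n) → SignedMap n
s ·* []      = s
s ·* (t ∷ w) = (s · t) ·* w

·*-apply : ∀ {n} (s : SignedMap n) w x → ⟦ s ·* w ⟧ x ≡ ⟦ s ⟧ (wordFun w x)
·*-apply s []      x = refl
·*-apply s (t ∷ w) x = ·*-apply (s · t) w x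

-- Multiplying by one generator t, which swaps a ↔ b: the folded partition of
-- g = f ∘ t is finer than the partition V obtained from that of f by merging the
-- classes of |a| and |b| (or, if these coincide, that class with the zero class)

module Step {n} (s : SignedMap n) (t : Refl n) {a b : X n} (sw : Swap (reflFun t) a b) where

  f g h : X n → X n
  f = ⟦ s ⟧
  h = reflFun t
  g = ⟦ s · t ⟧

  sf : Signed f
  sf = signed s
  sg : Signed g
  sg = signed (s · t)

  R G : Fin (suc n) → Fin (suc n) → Set
  R = Folded f
  G = Folded g

  R? : Decidable R
  R? = Folded? sf
  G? : Decidable G
  G? = Folded? sg

  R-equiv : IsEquivalence R
  R-equiv = Folded-isEquivalence sf
  G-equiv : IsEquivalence G
  G-equiv = Folded-isEquivalence sg

  module Oₑ = IsEquivalence (Orb-isEquivalence sf)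
  module Rₑ = IsEquivalence R-equiv

  i j : Fin (suc n)
  i = index a
  j = index b

  mergedPair : Dec (R i j) → Fin (suc n) × Fin (suc n)
  mergedPair (yes _) = Fin.zero , i
  mergedPair (no _)  = i , j

  u₀ v₀ : Fin (suc n)
  u₀ = proj₁ (mergedPair (R? i j))
  v₀ = proj₂ (mergedPair (R? i j))

  V : Fin (suc n) → Fin (suc n) → Set
  V = Join R u₀ v₀

  V? : Decidable V
  V? = Join? R? R-equiv u₀ v₀

  V-equiv : IsEquivalence V
  V-equiv = Join-isEquivalence R? R-equiv u₀ v₀

  module Vₑ = IsEquivalence V-equiv

  R⇒V : R ⇒ V
  R⇒V = inj₁

  V-ij : V i j
  V-ij = by-cases (R? i j)
    where
    by-cases : (d : Dec (R i j)) → Join R (proj₁ (mergedPair d)) (proj₂ (mergedPair d)) i j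
    by-cases (yes r) = inj₁ r
    by-cases (no _)  = inj₂ (inj₁ (Rₑ.refl , Rₑ.refl))

  V-0i : R i j → V Fin.zero i
  V-0i = by-cases (R? i j)
    where
    by-cases : (d : Dec (R i j)) → R i j → Join R (proj₁ (mergedPair d)) (proj₂ (mergedPair d)) Fin.zero i
    by-cases (yes _) _ = inj₂ (inj₁ (Rₑ.refl , Rₑ.refl))
    by-cases (no ¬r) r = contradiction r ¬r

  orbit⇒R : ∀ {z w} → Orb f z w → R (index z) (index w)
  orbit⇒R o = Folded-index sf (inj₁ (inj₁ o))

  orbit⇒V : ∀ {z w} → Orb g z w → V (index z) (index w)
  orbit⇒V = orbits-after-swap sw {f = f} (On.isEquivalence index V-equiv) (R⇒V ∘ orbit⇒R) V-ij V-ij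

  -- The self-negative g-orbits lie in the zero class of V.  This is shown with an
  -- auxiliary partition of X, Linked, into the f-orbits, with the orbits of a and b
  -- merged, those of −a and −b merged, and all points with |z| in the zero class of V merged.

  Near : X n → Set
  Near z = Orb f z a ⊎ Orb f z b

  Zero : X n → Set
  Zero z = V Fin.zero (index z)

  near-i : ∀ {z} → Near z → V (index z) i
  near-i (inj₁ o) = R⇒V (orbit⇒R o)
  near-i (inj₂ o) = Vₑ.trans (R⇒V (orbit⇒R o)) (Vₑ.sym V-ij)

  near-orbit : ∀ {z w} → Orb f z w → Near w → Near z
  near-orbit o (inj₁ o') = inj₁ (Oₑ.trans o o')
  near-orbit o (inj₂ o') = inj₂ (Oₑ.trans o o')

  zero-orbit : ∀ {z w} → Orb f z w → Zero w → Zero z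
  zero-orbit o zw = Vₑ.trans zw (R⇒V (orbit⇒R (Oₑ.sym o)))

  zero-near : ∀ {w v} → Zero w → Near w → Near v → Zero v
  zero-near zw nw nv = Vₑ.trans zw (Vₑ.trans (near-i nw) (Vₑ.sym (near-i nv)))

  opposite : ∀ {z u} → Orb f (neg z) u → Orb f z (neg u)
  opposite {z} o = subst (λ x → Orb f x _) (negneg z) (Orb-neg sf o)

  near-both-signs : ∀ {z} → Near z → Near (neg z) → Zero z
  near-both-signs nz n−z = Vₑ.trans (zero-i nz n−z) (Vₑ.sym (near-i nz))
    where
    zero-i : ∀ {z} → Near z → Near (neg z) → V Fin.zero i
    zero-i (inj₁ za) (inj₁ −za) = R⇒V (Folded-zero sf (Oₑ.trans (Oₑ.sym −za) (Orb-neg sf za)))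
    zero-i (inj₁ za) (inj₂ −zb) = V-0i (Folded-index sf (inj₂ (inj₁ (Oₑ.trans (Oₑ.sym za) (opposite −zb)))))
    zero-i (inj₂ zb) (inj₁ −za) = V-0i (Rₑ.sym (Folded-index sf (inj₂ (inj₁ (Oₑ.trans (Oₑ.sym zb) (opposite −za))))))
    zero-i (inj₂ zb) (inj₂ −zb) =
      Vₑ.trans (R⇒V (Folded-zero sf (Oₑ.trans (Oₑ.sym −zb) (Orb-neg sf zb)))) (Vₑ.sym V-ij)

  data Linked (z w : X n) : Set where
    same-orbit    : Orb f z w → Linked z w
    both-zero     : Zero z → Zero w → Linked z w
    both-near     : Near z → Near w → Linked z w
    both-opposite : Near (neg z) → Near (neg w) → Linked z w

  Linked-isEquivalence : IsEquivalence Linked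
  Linked-isEquivalence = record { refl = same-orbit Oₑ.refl ; sym = L-sym ; trans = L-trans }
    where
    L-sym : ∀ {z w} → Linked z w → Linked w z
    L-sym (same-orbit o)      = same-orbit (Oₑ.sym o)
    L-sym (both-zero p q)     = both-zero q p
    L-sym (both-near p q)     = both-near q p
    L-sym (both-opposite p q) = both-opposite q p
    L-trans : ∀ {z w v} → Linked z w → Linked w v → Linked z v
    L-trans (same-orbit o) (same-orbit o')        = same-orbit (Oₑ.trans o o')
    L-trans (same-orbit o) (both-zero zw zv)      = both-zero (zero-orbit o zw) zv
    L-trans (same-orbit o) (both-near nw nv)      = both-near (near-orbit o nw) nv
    L-trans (same-orbit o) (both-opposite nw nv)  = both-opposite (near-orbit (Orb-neg sf o) nw) nv
    L-trans (both-zero zz zw) (same-orbit o)      = both-zero zz (zero-orbit (Oₑ.sym o) zw)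
    L-trans (both-zero zz _) (both-zero _ zv)     = both-zero zz zv
    L-trans (both-zero zz zw) (both-near nw nv)   = both-zero zz (zero-near zw nw nv)
    L-trans (both-zero zz zw) (both-opposite nw nv) = both-zero zz (zero-near zw nw nv)
    L-trans (both-near nz nw) (same-orbit o)      = both-near nz (near-orbit (Oₑ.sym o) nw)
    L-trans (both-near nz nw) (both-zero zw zv)   = both-zero (zero-near zw nw nz) zv
    L-trans (both-near nz _) (both-near _ nv)     = both-near nz nv
    L-trans (both-near nz nw) (both-opposite n−w n−v) =
      both-zero (zero-near zw nw nz) (zero-near zw n−w n−v)
      where zw = near-both-signs nw n−w
    L-trans (both-opposite nz nw) (same-orbit o)  = both-opposite nz (near-orbit (Orb-neg sf (Oₑ.sym o)) nw)
    L-trans (both-opposite nz nw) (both-zero zw zv) = both-zero (zero-near zw nw nz) zv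
    L-trans (both-opposite n−z n−w) (both-near nw nv) =
      both-zero (zero-near zw n−w n−z) (zero-near zw nw nv)
      where zw = near-both-signs nw n−w
    L-trans (both-opposite nz _) (both-opposite _ nv) = both-opposite nz nv

  Linked-zero : ∀ {z} → Linked z (neg z) → Zero z
  Linked-zero (same-orbit o)          = R⇒V (Folded-zero sf o)
  Linked-zero (both-zero zz _)        = zz
  Linked-zero (both-near nz n−z)      = near-both-signs nz n−z
  Linked-zero {z} (both-opposite n−z n−−z) = near-both-signs (subst Near (negneg z) n−−z) n−z

  -- Linked contains the f-orbits and a ~ b, −a ~ −b, hence all g-orbits
  SN⇒zero : ∀ {z} → SN g z → Zero z
  SN⇒zero o = Linked-zero (orbits-after-swap sw {f = f} Linked-isEquivalence same-orbit
    (both-near (inj₁ Oₑ.refl) (inj₂ Oₑ.refl))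
    (both-opposite (inj₁ (0 , negneg a)) (inj₂ (0 , negneg b))) o)

  Ω⇒V : ∀ {x y} → Ω g x y → V (index x) (index y)
  Ω⇒V (inj₁ o)         = orbit⇒V o
  Ω⇒V (inj₂ (sx , sy)) = Vₑ.trans (Vₑ.sym (SN⇒zero sx)) (SN⇒zero sy)

  G⇒V : G ⇒ V
  G⇒V {Fin.zero}  {Fin.zero}  _        = Vₑ.refl
  G⇒V {Fin.zero}  {Fin.suc _} sn       = SN⇒zero sn
  G⇒V {Fin.suc _} {Fin.zero}  sn       = Vₑ.sym (SN⇒zero sn)
  G⇒V {Fin.suc _} {Fin.suc _} (inj₁ p) = Ω⇒V p
  G⇒V {Fin.suc _} {Fin.suc _} (inj₂ p) = Ω⇒V p

  blocks-step : blocks s ≤ suc (blocks (s · t))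
  blocks-step = ≤-trans (classes-join R? R-equiv u₀ v₀) (s≤s (classes-anti G? V? G⇒V))

  V⇒G : blocks s ≡ suc (blocks (s · t)) → V ⇒ G
  V⇒G tight {x} {y} vxy = by-cases (G? x y)
    where
    G≤V : classes G? ≤ classes V?
    G≤V = ≤-pred (subst (_≤ suc (classes V?)) tight (classes-join R? R-equiv u₀ v₀))
    by-cases : Dec (G x y) → G x y
    by-cases (yes gxy) = gxy
    by-cases (no ¬gxy) = contradiction G≤V (<⇒≱ (classes-strict G? V? G⇒V G-equiv V-equiv vxy ¬gxy))

  -- The points ±a, ±b, where g may differ from f.
  data Special (z : X n) : Set where
    is-a  : z ≡ a → Special z
    is-−a : z ≡ neg a → Special z
    is-b  : z ≡ b → Special z
    is-−b : z ≡ neg b → Special z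

  special-a : ∀ {z} → proj₂ z ≡ proj₂ a → Special z
  special-a {z} z~a = [ is-a , is-−a ] (same-index z a z~a)

  special-b : ∀ {z} → proj₂ z ≡ proj₂ b → Special z
  special-b {z} z~b = [ is-b , is-−b ] (same-index z b z~b)

  special? : ∀ z → Dec (Special z)
  special? z with proj₂ z ≟F proj₂ a | proj₂ z ≟F proj₂ b
  ... | yes z~a | _ = yes (special-a z~a)
  ... | no _ | yes z~b = yes (special-b z~b)
  ... | no z≁a | no z≁b = no λ { (is-a refl) → z≁a refl ; (is-−a refl) → z≁a refl
                               ; (is-b refl) → z≁b refl ; (is-−b refl) → z≁b refl }

  special-neg : ∀ {z} → Special (neg z) → Special z
  special-neg {z} sp = subst Special (negneg z) (flip-special sp)
    where
    flip-special : ∀ {w} → Special w → Special (neg w)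
    flip-special (is-a refl)  = is-−a refl
    flip-special (is-−a refl) = is-a (negneg a)
    flip-special (is-b refl)  = is-−b refl
    flip-special (is-−b refl) = is-b (negneg b)

  g-off : ∀ {z} → ¬ Special z → g z ≡ f z
  g-off {z} ¬sp = cong f (fixes sw z (¬sp ∘ special-a) (¬sp ∘ special-b))

  follow : ∀ k u → (∀ m → m < k → ¬ Special (iter f m u)) → iter g k u ≡ iter f k u
  follow zero    u avoid = refl
  follow (suc k) u avoid =
    trans (cong g (follow k u (λ m m<k → avoid m (m<n⇒m<1+n m<k)))) (g-off (avoid k (n<1+n k)))

  record Hit (x : X n) : Set where
    field
      steps  : ℕ
      hits   : Special (iter f steps (f x))
      avoids : ∀ m → m < steps → ¬ Special (iter f m (f x))

    reached : X n
    reached = iter f steps (f x)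

    f-path : Orb f x reached
    f-path = suc steps , sym (iter-suc f steps x)

    g-path : Orb g (f x) reached
    g-path = steps , follow steps (f x) avoids

  next-hit : ∀ {x} → Special x → Hit x
  next-hit {x} sx with period sf x
  ... | q , _ , back with least-ℕ (λ m → special? (iter f m (f x))) {q} (subst Special (sym (trans (iter-suc f q x) back)) sx)
  ...   | m , hit , minimal = record { steps = m ; hits = hit ; avoids = minimal }

  -- if a and b lie in different blocks of Ω̃(f), even up to sign, the swap merges their
  -- orbits: from a, the g-orbit runs along the f-orbit of b until it meets b, or meets −b,
  -- then runs along the f-orbit of −a back to −a and along the negated f-orbit of b to b
  merge-walk : ¬ Ω± f a b → Orb g a b
  merge-walk ¬ab = via₁ (Hit.hits H₁)
    where
    module Ω±ₑ = IsEquivalence (Ω±-isEquivalence sf)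
    H₁ = next-hit (is-b refl)
    open Hit H₁ using () renaming (steps to m₁; reached to s₁; f-path to b⇝s₁; g-path to fb⇝s₁)
    a⇝s₁ : Orb g a s₁
    a⇝s₁ = Orb-trans g (1 , cong f (sends sw)) fb⇝s₁
    via₁ : Special s₁ → Orb g a b
    via₁ (is-a e)  = contradiction (inj₁ (inj₁ (Oₑ.sym (subst (Orb f b) e b⇝s₁)))) ¬ab
    via₁ (is-−a e) = contradiction (Ω±ₑ.sym (inj₂ (inj₁ (subst (Orb f b) e b⇝s₁)))) ¬ab
    via₁ (is-b e)  = subst (Orb g a) e a⇝s₁
    via₁ (is-−b e) = via₂ (Hit.hits H₂)
      where
      SN-b : SN f b
      SN-b = subst (Orb f b) e b⇝s₁
      H₂ = next-hit (is-−a refl)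
      open Hit H₂ using () renaming (reached to s₂; f-path to −a⇝s₂; g-path to f−a⇝s₂)
      −fb⇝b : Orb g (neg (f b)) b
      −fb⇝b = m₁ , (begin
        iter g m₁ (neg (f b)) ≡⟨ follow m₁ _ (λ m m<m₁ sp → Hit.avoids H₁ m m<m₁
                                   (special-neg (subst Special (iter-neg sf m (f b)) sp))) ⟩
        iter f m₁ (neg (f b)) ≡⟨ iter-neg sf m₁ (f b) ⟩
        neg s₁                ≡⟨ cong neg e ⟩
        neg (neg b)           ≡⟨ negneg b ⟩
        b                     ∎)
        where open ≡-Reasoning
      via₂ : Special s₂ → Orb g a b
      via₂ (is-a e₂)  = contradiction (inj₁ (inj₂ (Oₑ.sym (subst (Orb f (neg a)) e₂ −a⇝s₂) , SN-b))) ¬ab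
      via₂ (is-b e₂)  = contradiction (inj₂ (inj₁ (opposite (subst (Orb f (neg a)) e₂ −a⇝s₂)))) ¬ab
      via₂ (is-−b e₂) =
        contradiction (inj₁ (inj₁ (subst (Orb f a) (negneg b) (opposite (subst (Orb f (neg a)) e₂ −a⇝s₂))))) ¬ab
      via₂ (is-−a e₂) =
        Orb-trans g (subst (Orb g a) e a⇝s₁)                              -- a ⇝ −b
          (Orb-trans g (1 , cong f (sends-back sw (sends (Swap-neg sw)))) -- −b ↦ f (−a)
            (Orb-trans g (subst (Orb g _) e₂ f−a⇝s₂)                       -- f (−a) ⇝ −a
              (Orb-trans g (1 , trans (cong f (sends (Swap-neg sw))) (preserves-neg sf b)) -- −a ↦ −f b
                −fb⇝b)))

  swap-linked : blocks s ≡ suc (blocks (s · t)) → Ω g a b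
  swap-linked tight = by-cases (R? i j)
    where
    by-cases : Dec (R i j) → Ω g a b
    by-cases (yes r) =
      inj₂ (Folded-zero⁻ sg (V⇒G tight (V-0i r)) , Folded-zero⁻ sg (V⇒G tight (Vₑ.trans (V-0i r) V-ij)))
    by-cases (no ¬r) = inj₁ (merge-walk (¬r ∘ Folded-index sf))

  -- … and hence Ω̃(f) refines Ω̃(g): since f = g ∘ t, every f-step z ↦ f z stays in a block of Ω̃(g)
  refines-step : blocks s ≡ suc (blocks (s · t)) → Ω f ⇒ Ω g
  refines-step tight (inj₁ o)         = orbit⇒Ωg o
    where
    ab = swap-linked tight
    orbit⇒Ωg : Orb f ⇒ Ω g
    orbit⇒Ωg = orbits-after-swap sw {f = g} (Ω-isEquivalence sg) inj₁ ab (Ω-neg sg ab)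
               ∘ Orb-cong (λ x → cong f (sym (involution sw x)))
  refines-step tight (inj₂ (sx , sy)) = inj₂ (SN⇒SN sx , SN⇒SN sy)
    where
    SN⇒SN : ∀ {x} → SN f x → SN g x
    SN⇒SN o = [ id , proj₁ ] (refines-step tight (inj₁ o))

  -- if f moves a to b ≠ a, then multiplying by the swap a ↔ b adds a block:
  -- it splits off a fixed point (or a fixed pair ±a if b = −a)
  blocks-split : f a ≡ b → a ≢ b → blocks s < blocks (s · t)
  blocks-split fab a≢b = split (proj₂ b ≟F proj₂ a)
    where
    G⇒R : G ⇒ R
    G⇒R = Folded-mono (orbits-after-swap sw {f = f} (Orb-isEquivalence sf) id (1 , fab) (Orb-neg sf (1 , fab)))
    fixed-orbit : ∀ {v w} → g v ≡ v → Orb g v w → w ≡ v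
    fixed-orbit e (k , refl) = iter-fixed g e k
    gb : g b ≡ b
    gb = trans (cong f (sends-back sw (sends sw))) fab
    split : Dec (proj₂ b ≡ proj₂ a) → blocks s < blocks (s · t)
    split (yes b~a) = split-opposite (same-index b a b~a)
      where
      split-opposite : b ≡ a ⊎ b ≡ neg a → blocks s < blocks (s · t)
      split-opposite (inj₁ b≡a)  = contradiction (sym b≡a) a≢b
      split-opposite (inj₂ b≡−a) = classes-strict G? R? G⇒R G-equiv R-equiv {Fin.zero} {i} (Folded-zero sf (1 , trans fab b≡−a))
          (λ g0a → neg≢ a (fixed-orbit ga (Folded-zero⁻ sg g0a)))
        where
        ga : g a ≡ a
        ga = begin
          f (h a)       ≡⟨ cong f (sends sw) ⟩
          f b           ≡⟨ cong f b≡−a ⟩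
          f (neg a)     ≡⟨ preserves-neg sf a ⟩
          neg (f a)     ≡⟨ cong neg (trans fab b≡−a) ⟩
          neg (neg a)   ≡⟨ negneg a ⟩
          a             ∎
          where open ≡-Reasoning
    split (no b≁a) = classes-strict G? R? G⇒R G-equiv R-equiv {i} {j} (orbit⇒R (1 , fab)) (not-linked ∘ Folded-index⁻ sg)
      where
      g−b : g (neg b) ≡ neg b
      g−b = trans (preserves-neg sg b) (cong neg gb)
      not-linked : ¬ Ω± g a b
      not-linked (inj₁ (inj₁ o))       = a≢b (fixed-orbit gb (Orb-sym sg o))
      not-linked (inj₁ (inj₂ (_ , sb))) = neg≢ b (fixed-orbit gb sb)
      not-linked (inj₂ (inj₁ o))       = b≁a (cong proj₂ (sym (fixed-orbit g−b (Orb-sym sg o))))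
      not-linked (inj₂ (inj₂ (_ , s−b))) = neg≢ (neg b) (fixed-orbit g−b s−b)

module StepBy {n} (s : SignedMap n) (t : Refl n) = Step s t (proj₂ (proj₂ (reflection-swap t)))

blocks-word : ∀ {n} (s : SignedMap n) w → blocks s ≤ blocks (s ·* w) + length w
blocks-word s []      = m≤m+n (blocks s) 0
blocks-word s (t ∷ w) = begin
  blocks s                              ≤⟨ StepBy.blocks-step s t ⟩
  suc (blocks (s · t))                  ≤⟨ s≤s (blocks-word (s · t) w) ⟩
  suc (blocks ((s · t) ·* w) + length w) ≡⟨ sym (+-suc _ (length w)) ⟩
  blocks (s ·* (t ∷ w)) + length (t ∷ w) ∎
  where open ≤-Reasoning

tight-links : ∀ {A B D} → A ≤ suc B → B ≤ D → A ≡ suc D → A ≡ suc B × B ≡ D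
tight-links A≤1+B B≤D refl = cong suc (sym B≡D) , B≡D
  where B≡D = ≤-antisym B≤D (≤-pred A≤1+B)

refines-word : ∀ {n} (s : SignedMap n) w → blocks s ≡ blocks (s ·* w) + length w → Ω ⟦ s ⟧ ⇒ Ω ⟦ s ·* w ⟧
refines-word s []      _     = id
refines-word s (t ∷ w) tight = refines-word (s · t) w tight₂ ∘ StepBy.refines-step s t tight₁
  where
  links = tight-links (StepBy.blocks-step s t) (blocks-word (s · t) w) (trans tight (+-suc _ (length w)))
  tight₁ = proj₁ links
  tight₂ = proj₂ links

wordFun-++ : ∀ {n} (u v : List (Refl n)) x → wordFun (u ++ v) x ≡ wordFun u (wordFun v x)
wordFun-++ []      v x = refl
wordFun-++ (t ∷ u) v x = cong (reflFun t) (wordFun-++ u v x)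

record Factorization {n} (s : SignedMap n) : Set where
  field
    word      : List (Refl n)
    evaluates : ∀ x → wordFun word x ≡ ⟦ s ⟧ x
    short     : length word + blocks s ≤ suc n

identity-factorization : ∀ {n} (s : SignedMap n) → (∀ i → ⟦ s ⟧ (true , i) ≡ (true , i)) → Factorization s
identity-factorization s fixes-all =
  record { word = [] ; evaluates = is-id ; short = classes-≤ (Folded? (signed s)) }
  where
  is-id : ∀ x → x ≡ ⟦ s ⟧ x
  is-id (true  , i) = sym (fixes-all i)
  is-id (false , i) = sym (trans (preserves-neg (signed s) (true , i)) (cong neg (fixes-all i)))

extend : ∀ {n} (s : SignedMap n) t {a b} → Swap (reflFun t) a b → blocks s < blocks (s · t) →
         Factorization (s · t) → Factorization s
extend {n} s t sw grows F = record { word = word ++ t ∷ [] ; evaluates = evaluates′ ; short = short′ }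
  where
  open Factorization F
  evaluates′ : ∀ x → wordFun (word ++ t ∷ []) x ≡ ⟦ s ⟧ x
  evaluates′ x = begin
    wordFun (word ++ t ∷ []) x        ≡⟨ wordFun-++ word (t ∷ []) x ⟩
    wordFun word (reflFun t x)        ≡⟨ evaluates (reflFun t x) ⟩
    ⟦ s ⟧ (reflFun t (reflFun t x))    ≡⟨ cong ⟦ s ⟧ (involution sw x) ⟩
    ⟦ s ⟧ x                            ∎
    where open ≡-Reasoning
  short′ : length (word ++ t ∷ []) + blocks s ≤ suc n
  short′ = begin
    length (word ++ t ∷ []) + blocks s ≡⟨ cong (_+ blocks s) (trans (length-++ word) (+-comm (length word) 1)) ⟩
    suc (length word) + blocks s      ≡⟨ sym (+-suc (length word) (blocks s)) ⟩
    length word + suc (blocks s)      ≤⟨ +-monoʳ-≤ (length word) grows ⟩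
    length word + blocks (s · t)      ≤⟨ short ⟩
    suc n                             ∎
    where open ≤-Reasoning

-- Every signed map has a short factorization: if it moves some +i, the swap of +i with
-- its image adds a block, which can happen at most n + 1 − blocks s times (the fuel d).
factorize : ∀ {n} d (s : SignedMap n) → suc n ≤ blocks s + d → Factorization s
factorize {n} d s enough = by-cases (all? λ i → ⟦ s ⟧ (true , i) ≟X (true , i))
  where
  by-cases : Dec (∀ i → ⟦ s ⟧ (true , i) ≡ (true , i)) → Factorization s
  by-cases (yes fixes-all) = identity-factorization s fixes-all
  by-cases (no ¬fixes-all) = moving (¬∀⟶∃¬ n _ (λ i → ⟦ s ⟧ (true , i) ≟X (true , i)) ¬fixes-all)
    where
    moving : (∃ λ i → ⟦ s ⟧ (true , i) ≢ (true , i)) → Factorization s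
    moving (i , moved) = swapping (swap-reflection i (⟦ s ⟧ (true , i)) (moved ∘ sym))
      where
      swapping : ∃[ t ] Swap (reflFun t) (true , i) (⟦ s ⟧ (true , i)) → Factorization s
      swapping (t , sw) = extend s t sw grows (by-fuel d enough)
        where
        grows : blocks s < blocks (s · t)
        grows = Step.blocks-split s t sw refl (moved ∘ sym)
        by-fuel : ∀ d → suc n ≤ blocks s + d → Factorization (s · t)
        by-fuel zero    enough = contradiction (classes-≤ (Folded? (signed (s · t))))
          (<⇒≱ (≤-<-trans (subst (suc n ≤_) (+-identityʳ (blocks s)) enough) grows))
        by-fuel (suc d) enough =
          factorize d (s · t) (≤-trans enough (≤-trans (≤-reflexive (+-suc (blocks s) d)) (+-monoˡ-≤ d grows)))

length-lower : ∀ {n} (s : SignedMap n) {k} → ProductOf ⟦ s ⟧ k → suc n ≤ blocks s + k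
length-lower {n} s (w , refl , eval) = begin
  suc n                             ≡⟨ sym (blocks-identity {n}) ⟩
  blocks (identity {n})             ≤⟨ blocks-word identity w ⟩
  blocks (identity ·* w) + length w ≡⟨ cong (_+ length w) (blocks-cong _ s λ x → trans (·*-apply identity w x) (eval x)) ⟩
  blocks s + length w               ∎
  where open ≤-Reasoning

length-upper : ∀ {n} (τ : SignedPerm n) {a} → LengthB τ a → a + blocks (permutation τ) ≤ suc n
length-upper {n} τ (_ , minimal) =
  ≤-trans (+-monoˡ-≤ _ (minimal (length word) (word , refl , evaluates))) short
  where open Factorization (factorize (suc n) (permutation τ) (m≤n+m (suc n) _))

lemma4p7 : (n : ℕ) → 1 ≤ n → (σ τ : SignedPerm n) →
    σ ≤B τ → OmegaT σ ≤P OmegaT τ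
lemma4p7 n _ σ τ (a , b , c , ℓτ , (σ-word , _) , ((w , refl , eval) , _) , a≡b+c) _ _ =
  Ω-mono (Orb-cong σw≗τ) ∘ refines-word σ′ w tight
  where
  σ′ τ′ : SignedMap n
  σ′ = permutation σ
  τ′ = permutation τ
  σw≗τ : ∀ z → ⟦ σ′ ·* w ⟧ z ≡ fun τ z
  σw≗τ z = trans (·*-apply σ′ w z) (trans (cong (fun σ) (eval z)) (inv-r σ (fun τ z)))
  -- the word for σ⁻¹τ removes one block per letter: ℓ(σ) + ℓ(σ⁻¹τ) = ℓ(τ) forces it
  tight : blocks σ′ ≡ blocks (σ′ ·* w) + length w
  tight = ≤-antisym (blocks-word σ′ w) (+-cancelʳ-≤ b _ _ (begin
    blocks (σ′ ·* w) + length w + b ≡⟨ cong (λ k → k + length w + b) (blocks-cong _ τ′ σw≗τ) ⟩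
    blocks τ′ + length w + b        ≡⟨ +-assoc (blocks τ′) (length w) b ⟩
    blocks τ′ + (length w + b)      ≡⟨ cong (blocks τ′ +_) (trans (+-comm (length w) b) (sym a≡b+c)) ⟩
    blocks τ′ + a                   ≡⟨ +-comm (blocks τ′) a ⟩
    a + blocks τ′                   ≤⟨ length-upper τ ℓτ ⟩
    suc n                           ≤⟨ length-lower σ′ σ-word ⟩
    blocks σ′ + b                   ∎))
    where open ≤-Reasoning
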